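{- For every even integer $q\ge 2$ and all integers $s_1,\ldots,s_q\in\{q+2,q+3,\ldots,2q+2\}$, there exists a graph $G$ whose vertex set is the union of $q$ pairwise disjoint sets $V_1,\ldots,V_q$ such that: (i) $|V_i|=s_i$ for each $i\in[q]$; (ii) the edge set of $G$ can be partitioned into four sets $M_1,\ldots,M_4$ such that for every $1\le i<j\le q$, the edges of $M_1$ (respectively $M_2$) with both endpoints in $V_i\cup V_j$ form a matching of size $q+2$, and the edges of $M_3$ (respectively $M_4$) with both endpoints in $V_i\cup V_j$ form a matching of size $q$; (iii) the chromatic number of $G$ is $q$ and the color classes of every proper $q$-coloring of $G$ are precisely the sets $V_1,\ldots,V_q$ (in particular each $V_i$ is independent).
   Context: $[q]=\{1,\ldots,q\}$. Graphs are finite and simple. -}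

module Defs where

open import Data.Nat using (ℕ; zero; suc; _+_; _*_; _<_)
open import Data.Bool using (Bool; true; false; if_then_else_; _∧_; _∨_)
open import Data.Fin using (Fin; zero; suc; toℕ; _<?_)
open import Data.Fin.Properties using (_≟_)
open import Data.Product using (Σ; _×_; _,_)
open import Relation.Nullary using (¬_)
open import Relation.Nullary.Decidable using (⌊_⌋)
open import Relation.Binary.PropositionalEquality using (_≡_; _≢_)
open import Function using (_∘_)

record Graph (n : ℕ) : Set where
  field
    Adj     : Fin n → Fin n → Bool
    Adj-sym : ∀ u v → Adj u v ≡ Adj v u
    Adj-irr : ∀ v → Adj v v ≡ false
open Graph public

countF : ∀ {n} → (Fin n → Bool) → ℕ
countF {zero}  f = 0
countF {suc n} f = (if f zero then 1 else 0) + countF (f ∘ suc)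

sumF : ∀ {n} → (Fin n → ℕ) → ℕ
sumF {zero}  f = 0
sumF {suc n} f = f zero + sumF (f ∘ suc)

countPairs : ∀ {n} → (Fin n → Fin n → Bool) → ℕ
countPairs P = sumF (λ u → countF (λ v → ⌊ u <? v ⌋ ∧ P u v))

IsMatching : ∀ {n} → (Fin n → Fin n → Bool) → Set
IsMatching E = ∀ u v w → E u v ≡ true → E u w ≡ true → v ≡ w

ProperColoring : ∀ {n} → Graph n → (k : ℕ) → (Fin n → Fin k) → Set
ProperColoring G k c = ∀ u v → Adj G u v ≡ true → c u ≢ c v

Colorable : ∀ {n} → Graph n → ℕ → Set
Colorable {n} G k = Σ (Fin n → Fin k) (ProperColoring G k)

ChromaticNumber : ∀ {n} → Graph n → ℕ → Set
ChromaticNumber G k = Colorable G k × (∀ j → j < k → ¬ Colorable G j)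

msize : ℕ → Fin 4 → ℕ
msize q zero          = q + 2
msize q (suc zero)    = q + 2
msize q (suc (suc _)) = q

restrictedEdges : ∀ {n q} → Graph n → (Fin n → Fin q) → (Fin n → Fin n → Fin 4)
                → Fin 4 → Fin q → Fin q → Fin n → Fin n → Bool
restrictedEdges G part lab k i j u v =
  Adj G u v ∧ ⌊ lab u v ≟ k ⌋
  ∧ (⌊ part u ≟ i ⌋ ∨ ⌊ part u ≟ j ⌋)
  ∧ (⌊ part v ≟ i ⌋ ∨ ⌊ part v ≟ j ⌋)

module Submission where

-- Each part V_p is a core of q + 2 vertices, numbered 0 … q + 1, followed by extra
-- vertices.  Between parts V_i and V_j (i < j) each of the four matchings is the graph of
-- a partial injection from the indices of V_i into those of V_j: M₁ (a ↦ a) and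
-- M₂ (a ↦ a + 1 mod q + 2) match the two cores, and M₃, M₄ give the extra vertices their
-- edges.
--
-- By M₁ the vertices of index 0 form a q-clique, so a proper q-colouring c gives them
-- distinct colours g p.  The core vertex (p , a + 1) is adjacent to (m , a) for m < p
-- (by M₂) and to (m , a + 1) for m > p (by M₁); once these are known to have colour g m,
-- only g p is left for it.  Climbing through the core levels, and inside a level
-- descending through the parts, every core vertex of V_p gets colour g p.  An extra
-- vertex (p , a) is adjacent to the core vertex (m , a − q) of every other part (by M₄
-- from lower parts, by M₃ into higher ones), so it gets colour g p as well.

open import Algebra.Bundles using (CommutativeMonoid)
open import Data.Bool using (Bool; true; false; if_then_else_; _∧_; _∨_)
open import Data.Bool.Properties
  using (∧-zeroʳ; ∨-zeroʳ; ∧-identityʳ; ∧-comm; ∧-assoc; ∨-comm; ∨-identityʳ; ∧-distribʳ-∨; ∧-commutativeMonoid)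
open import Data.Empty using (⊥; ⊥-elim)
open import Data.Fin using (Fin; zero; suc; toℕ; fromℕ<; _>_; punchOut; _↑ˡ_; _↑ʳ_; splitAt; _<?_)
open import Data.Fin.Induction using (>-wellFounded)
open import Data.Fin.Patterns using (0F; 1F; 2F; 3F)
open import Data.Fin.Properties
  using (_≟_; any?; <-cmp; <-asym; toℕ-injective; toℕ<n; toℕ-fromℕ<; suc-injective;
         <⇒notInjective; punchOut-injective; splitAt-↑ˡ; splitAt-↑ʳ; splitAt⁻¹-↑ˡ; splitAt⁻¹-↑ʳ)
open import Data.Nat using (ℕ; zero; suc; _+_; _*_; _∸_; _≤_; _<_; z≤n; s≤s; s≤s⁻¹; NonZero; >-nonZero)
open import Data.Nat.Divisibility using (_∣_)
import Data.Nat.Properties as ℕ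
open import Data.Nat.Tactic.RingSolver using (solve-∀)
open import Data.Product using (Σ; _×_; _,_; proj₁; proj₂)
open import Data.Sum using (_⊎_; inj₁; inj₂)
open import Defs
open import Function using (_∘_; _∘₂_)
open import Function.Bundles using (mk⇔)
open import Function.Definitions using (Injective)
open import Induction.WellFounded using (Acc; acc)
open import Relation.Binary using (tri<; tri≈; tri>)
open import Relation.Binary.PropositionalEquality
open import Relation.Nullary using (¬_; Dec; yes; no; does; contradiction)
open import Relation.Nullary.Decidable using (⌊_⌋; dec-true; dec-false; does-⇔; ⌊⌋-map′; isYes≗does)

open import Algebra.Properties.CommutativeSemigroup ℕ.+-commutativeSemigroup using (interchange)
import Algebra.Properties.CommutativeSemigroup
  (CommutativeMonoid.commutativeSemigroup ∧-commutativeMonoid) as ∧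

∧-true : ∀ {a b} → a ∧ b ≡ true → a ≡ true × b ≡ true
∧-true {true} {true} _ = refl , refl

∨-true : ∀ a b → a ∨ b ≡ true → a ≡ true ⊎ b ≡ true
∨-true true  _ _  = inj₁ refl
∨-true false _ eq = inj₂ eq

does-true⇒ : ∀ {A : Set} (a? : Dec A) → does a? ≡ true → A
does-true⇒ (yes a) _ = a

-- ⌊_⌋ is isYes, which (unlike does) only computes on a decision in canonical form.
⌊⌋-true⇒ : ∀ {A : Set} (a? : Dec A) → ⌊ a? ⌋ ≡ true → A
⌊⌋-true⇒ (yes a) _ = a

⌊⌋-yes : ∀ {A : Set} (a? : Dec A) → A → ⌊ a? ⌋ ≡ true
⌊⌋-yes a? a = trans (isYes≗does a?) (dec-true a? a)

⌊⌋-no : ∀ {A : Set} (a? : Dec A) → ¬ A → ⌊ a? ⌋ ≡ false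
⌊⌋-no a? ¬a = trans (isYes≗does a?) (dec-false a? ¬a)

indicator : Bool → ℕ
indicator b = if b then 1 else 0

indicator-∨ : ∀ a b → a ∧ b ≡ false → indicator (a ∨ b) ≡ indicator a + indicator b
indicator-∨ true  false _ = refl
indicator-∨ false b     _ = refl

sumF-cong : ∀ {n} {f g : Fin n → ℕ} → (∀ x → f x ≡ g x) → sumF f ≡ sumF g
sumF-cong {zero}  eq = refl
sumF-cong {suc n} eq = cong₂ _+_ (eq zero) (sumF-cong (eq ∘ suc))

sumF-zero : ∀ {n} {f : Fin n → ℕ} → (∀ x → f x ≡ 0) → sumF f ≡ 0
sumF-zero {zero}  eq = refl
sumF-zero {suc n} eq rewrite eq zero = sumF-zero (eq ∘ suc)

sumF-single : ∀ {n} (f : Fin n → ℕ) i → (∀ x → x ≢ i → f x ≡ 0) → sumF f ≡ f i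
sumF-single f zero    eq = trans (cong (f zero +_) (sumF-zero (λ x → eq (suc x) λ ()))) (ℕ.+-identityʳ _)
sumF-single f (suc i) eq rewrite eq zero (λ ()) =
  sumF-single (f ∘ suc) i (λ x x≢i → eq (suc x) (x≢i ∘ suc-injective))

sumF-+ : ∀ {n} (f g : Fin n → ℕ) → sumF (λ x → f x + g x) ≡ sumF f + sumF g
sumF-+ {zero}  f g = refl
sumF-+ {suc n} f g rewrite sumF-+ (f ∘ suc) (g ∘ suc) = interchange (f zero) (g zero) _ _

sumF-comm : ∀ {m n} (f : Fin m → Fin n → ℕ) →
            sumF (λ x → sumF (f x)) ≡ sumF (λ y → sumF (λ x → f x y))
sumF-comm {zero}  {n} f = sym (sumF-zero {n} (λ _ → refl))
sumF-comm {suc m}     f rewrite sumF-comm (f ∘ suc) = sym (sumF-+ (f zero) _)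

sumF-↑ : ∀ m {n} (f : Fin (m + n) → ℕ) → sumF f ≡ sumF (f ∘ (_↑ˡ n)) + sumF (f ∘ (m ↑ʳ_))
sumF-↑ zero    f = refl
sumF-↑ (suc m) f rewrite sumF-↑ m (f ∘ suc) = sym (ℕ.+-assoc (f zero) _ _)

sumF² : ∀ {m n} → (Fin m → Fin n → ℕ) → ℕ
sumF² f = sumF (λ x → sumF (f x))

sumF²-+ : ∀ {m n} (f g : Fin m → Fin n → ℕ) → sumF² (λ x y → f x y + g x y) ≡ sumF² f + sumF² g
sumF²-+ {m} {n} f g =
  trans (sumF-cong {m} (λ x → sumF-+ {n} (f x) (g x))) (sumF-+ {m} (λ x → sumF (f x)) (λ x → sumF (g x)))

countF-cong : ∀ {n} {f g : Fin n → Bool} → (∀ x → f x ≡ g x) → countF f ≡ countF g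
countF-cong {zero}  eq = refl
countF-cong {suc n} eq = cong₂ _+_ (cong indicator (eq zero)) (countF-cong (eq ∘ suc))

countF≡sumF : ∀ {n} (f : Fin n → Bool) → countF f ≡ sumF (indicator ∘ f)
countF≡sumF {zero}  f = refl
countF≡sumF {suc n} f = cong (indicator (f zero) +_) (countF≡sumF (f ∘ suc))

countF-false : ∀ {n} {f : Fin n → Bool} → (∀ x → f x ≡ false) → countF f ≡ 0
countF-false {zero}  eq = refl
countF-false {suc n} eq rewrite eq zero = countF-false (eq ∘ suc)

countF-true : ∀ n → countF {n} (λ _ → true) ≡ n
countF-true zero    = refl
countF-true (suc n) = cong suc (countF-true n)

countF-∨ : ∀ {n} (f g : Fin n → Bool) → (∀ x → f x ∧ g x ≡ false) →
           countF (λ x → f x ∨ g x) ≡ countF f + countF g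
countF-∨ f g disjoint = begin
  countF (λ x → f x ∨ g x)                       ≡⟨ countF≡sumF (λ x → f x ∨ g x) ⟩
  sumF (λ x → indicator (f x ∨ g x))             ≡⟨ sumF-cong (λ x → indicator-∨ (f x) (g x) (disjoint x)) ⟩
  sumF (λ x → indicator (f x) + indicator (g x)) ≡⟨ sumF-+ (indicator ∘ f) (indicator ∘ g) ⟩
  sumF (indicator ∘ f) + sumF (indicator ∘ g)    ≡⟨ sym (cong₂ _+_ (countF≡sumF f) (countF≡sumF g)) ⟩
  countF f + countF g                            ∎
  where open ≡-Reasoning

countPairs-cong : ∀ {n} {E F : Fin n → Fin n → Bool} → (∀ u v → E u v ≡ F u v) → countPairs E ≡ countPairs F
countPairs-cong {n} eq = sumF-cong {n} (λ u → countF-cong {n} (λ v → cong (⌊ u <? v ⌋ ∧_) (eq u v)))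

inRange : ℕ → ℕ → ℕ → Bool
inRange l h a = does (l ℕ.≤? a) ∧ does (a ℕ.<? h)

inRange-sound : ∀ l h {a} → inRange l h a ≡ true → l ≤ a × a < h
inRange-sound l h {a} e with ∧-true {does (l ℕ.≤? a)} e
... | l≤a , a<h = does-true⇒ (l ℕ.≤? a) l≤a , does-true⇒ (a ℕ.<? h) a<h

inRange-intro : ∀ {l h a} → l ≤ a → a < h → inRange l h a ≡ true
inRange-intro {l} {h} {a} l≤a a<h rewrite dec-true (l ℕ.≤? a) l≤a | dec-true (a ℕ.<? h) a<h = refl

-- The decisions on ℕ go through the builtin _<ᵇ_, which does not reduce
-- suc m <ᵇ suc n for open m, n; these equations have to be proved.
≤?-suc : ∀ l a → does (suc l ℕ.≤? suc a) ≡ does (l ℕ.≤? a)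
≤?-suc l a = does-⇔ (mk⇔ s≤s⁻¹ s≤s) (suc l ℕ.≤? suc a) (l ℕ.≤? a)

<?-suc : ∀ a h → does (suc a ℕ.<? suc h) ≡ does (a ℕ.<? h)
<?-suc a h = does-⇔ (mk⇔ s≤s⁻¹ s≤s) (suc a ℕ.<? suc h) (a ℕ.<? h)

≟-suc : ∀ a b → does (suc a ℕ.≟ suc b) ≡ does (a ℕ.≟ b)
≟-suc a b = does-⇔ (mk⇔ ℕ.suc-injective (cong suc)) (suc a ℕ.≟ suc b) (a ℕ.≟ b)

countF-inRange : ∀ {n} l h → l ≤ h → h ≤ n → countF {n} (λ t → inRange l h (toℕ t)) ≡ h ∸ l
countF-inRange {zero}  zero    zero    _         _         = refl
countF-inRange {suc n} zero    zero    _         _         =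
  countF-false {n} (λ t → dec-false (toℕ t ℕ.<? 0) λ ())
countF-inRange {suc n} zero    (suc h) _         (s≤s h≤n) = cong₂ _+_
  (cong indicator (dec-true (0 ℕ.<? suc h) (s≤s z≤n)))
  (trans (countF-cong {n} (λ t → <?-suc (toℕ t) h)) (countF-inRange 0 h z≤n h≤n))
countF-inRange {suc n} (suc l) (suc h) (s≤s l≤h) (s≤s h≤n) = cong₂ _+_
  (cong indicator (cong (_∧ does (0 ℕ.<? suc h)) (dec-false (suc l ℕ.≤? 0) λ ())))
  (trans (countF-cong {n} (λ t → cong₂ _∧_ (≤?-suc l (toℕ t)) (<?-suc (toℕ t) h)))
         (countF-inRange l h l≤h h≤n))

countF-toℕ≡ : ∀ {n} b → b < n → countF {n} (λ t → does (toℕ t ℕ.≟ b)) ≡ 1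
countF-toℕ≡ {suc n} zero    _         = cong suc (countF-false {n} (λ t → dec-false (suc (toℕ t) ℕ.≟ 0) λ ()))
countF-toℕ≡ {suc n} (suc b) (s≤s b<n) = cong₂ _+_
  (cong indicator (dec-false (0 ℕ.≟ suc b) λ ()))
  (trans (countF-cong {n} (λ t → ≟-suc (toℕ t) b)) (countF-toℕ≡ b b<n))

-- Flattening the parts

Part : ∀ {q} → (Fin q → ℕ) → Set
Part {q} s = Σ (Fin q) (Fin ∘ s)

Part-≡ : ∀ {q} {s : Fin q → ℕ} {x y : Part s} → proj₁ x ≡ proj₁ y → toℕ (proj₂ x) ≡ toℕ (proj₂ y) → x ≡ y
Part-≡ {x = p , t} {.p , t′} refl e = cong (p ,_) (toℕ-injective e)

embed : ∀ {q} (s : Fin q → ℕ) (p : Fin q) → Fin (s p) → Fin (sumF s)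
embed {suc q} s zero    t = t ↑ˡ sumF (s ∘ suc)
embed {suc q} s (suc p) t = s zero ↑ʳ embed (s ∘ suc) p t

locate : ∀ {q} (s : Fin q → ℕ) → Fin (sumF s) → Part s
locate {suc q} s u with splitAt (s zero) u
... | inj₁ t = zero , t
... | inj₂ u′ with locate (s ∘ suc) u′
...   | p , t = suc p , t

locate-embed : ∀ {q} (s : Fin q → ℕ) p t → locate s (embed s p t) ≡ (p , t)
locate-embed {suc q} s zero    t rewrite splitAt-↑ˡ (s zero) t (sumF (s ∘ suc)) = refl
locate-embed {suc q} s (suc p) t
  rewrite splitAt-↑ʳ (s zero) (sumF (s ∘ suc)) (embed (s ∘ suc) p t)
        | locate-embed (s ∘ suc) p t = refl

embed-locate : ∀ {q} (s : Fin q → ℕ) u → embed s (proj₁ (locate s u)) (proj₂ (locate s u)) ≡ u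
embed-locate {suc q} s u with splitAt (s zero) u in eq
... | inj₁ t = splitAt⁻¹-↑ˡ eq
... | inj₂ u′ with locate (s ∘ suc) u′ | embed-locate (s ∘ suc) u′
...   | p , t | ih = trans (cong (s zero ↑ʳ_) ih) (splitAt⁻¹-↑ʳ eq)

locate-injective : ∀ {q} (s : Fin q → ℕ) {u v} → locate s u ≡ locate s v → u ≡ v
locate-injective s {u} {v} eq = begin
  u                                                  ≡⟨ sym (embed-locate s u) ⟩
  embed s (proj₁ (locate s u)) (proj₂ (locate s u))  ≡⟨ cong (λ (p , t) → embed s p t) eq ⟩
  embed s (proj₁ (locate s v)) (proj₂ (locate s v))  ≡⟨ embed-locate s v ⟩
  v                                                  ∎
  where open ≡-Reasoning

sumPart : ∀ {q} (s : Fin q → ℕ) → ((p : Fin q) → Fin (s p) → ℕ) → ℕ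
sumPart s f = sumF (λ p → sumF (f p))

sumF-embed : ∀ {q} (s : Fin q → ℕ) (f : Fin (sumF s) → ℕ) → sumF f ≡ sumPart s (λ p t → f (embed s p t))
sumF-embed {zero}  s f = refl
sumF-embed {suc q} s f rewrite sumF-↑ (s zero) f =
  cong (sumF (f ∘ (_↑ˡ sumF (s ∘ suc))) +_) (sumF-embed (s ∘ suc) (f ∘ (s zero ↑ʳ_)))

sumF-locate : ∀ {q} (s : Fin q → ℕ) (f : Part s → ℕ) → sumF (f ∘ locate s) ≡ sumPart s (λ p t → f (p , t))
sumF-locate s f = trans (sumF-embed s (f ∘ locate s))
  (sumF-cong (λ p → sumF-cong (λ t → cong f (locate-embed s p t))))

sumPart-at : ∀ {q} (s : Fin q → ℕ) (F : (p : Fin q) → Fin (s p) → Bool) i →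
             sumPart s (λ p t → indicator (⌊ p ≟ i ⌋ ∧ F p t)) ≡ countF (F i)
sumPart-at s F i = begin
  sumPart s (λ p t → indicator (⌊ p ≟ i ⌋ ∧ F p t))
    ≡⟨ sumF-single _ i off-i ⟩
  sumF (λ t → indicator (⌊ i ≟ i ⌋ ∧ F i t))
    ≡⟨ sumF-cong (λ t → cong (λ b → indicator (b ∧ F i t)) (⌊⌋-yes (i ≟ i) refl)) ⟩
  sumF (λ t → indicator (F i t))
    ≡⟨ sym (countF≡sumF (F i)) ⟩
  countF (F i) ∎
  where
  open ≡-Reasoning
  off-i : ∀ p → p ≢ i → sumF (λ t → indicator (⌊ p ≟ i ⌋ ∧ F p t)) ≡ 0
  off-i p p≢i = sumF-zero {s p} (λ t → cong (λ b → indicator (b ∧ F p t)) (⌊⌋-no (p ≟ i) p≢i))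

anyTrue : ∀ {L} → (Fin L → Bool) → Bool
anyTrue {zero}  f = false
anyTrue {suc L} f = f zero ∨ anyTrue (f ∘ suc)

firstTrue : ∀ {L} → (Fin (suc L) → Bool) → Fin (suc L)
firstTrue {zero}  f = zero
firstTrue {suc L} f = if f zero then zero else suc (firstTrue (f ∘ suc))

anyTrue-cong : ∀ {L} {f g : Fin L → Bool} → (∀ k → f k ≡ g k) → anyTrue f ≡ anyTrue g
anyTrue-cong {zero}  eq = refl
anyTrue-cong {suc L} eq = cong₂ _∨_ (eq zero) (anyTrue-cong (eq ∘ suc))

anyTrue-intro : ∀ {L} (f : Fin L → Bool) k → f k ≡ true → anyTrue f ≡ true
anyTrue-intro f zero    fk rewrite fk = refl
anyTrue-intro f (suc k) fk rewrite anyTrue-intro (f ∘ suc) k fk = ∨-zeroʳ (f zero)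

anyTrue-false : ∀ {L} {f : Fin L → Bool} → (∀ k → f k ≡ false) → anyTrue f ≡ false
anyTrue-false {zero}  _  = refl
anyTrue-false {suc L} eq rewrite eq zero = anyTrue-false (eq ∘ suc)

firstTrue-cong : ∀ {L} {f g : Fin (suc L) → Bool} → (∀ k → f k ≡ g k) → firstTrue f ≡ firstTrue g
firstTrue-cong {zero}  eq = refl
firstTrue-cong {suc L} eq rewrite eq zero | firstTrue-cong (eq ∘ suc) = refl

AtMostOne : ∀ {L} → (Fin L → Bool) → Set
AtMostOne f = ∀ {k k′} → f k ≡ true → f k′ ≡ true → k ≡ k′

anyTrue∧firstTrue : ∀ {L} (f : Fin (suc L) → Bool) → AtMostOne f →
                    ∀ k → anyTrue f ∧ ⌊ firstTrue f ≟ k ⌋ ≡ f k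
anyTrue∧firstTrue {zero}  f _   zero = trans (∧-identityʳ _) (∨-identityʳ _)
anyTrue∧firstTrue {suc L} f one k with f zero in f₀
anyTrue∧firstTrue {suc L} f one zero    | true  = sym f₀
anyTrue∧firstTrue {suc L} f one (suc k) | true  with f (suc k) in fₖ
... | true  = contradiction (one f₀ fₖ) λ ()
... | false = refl
anyTrue∧firstTrue {suc L} f one zero    | false = trans (∧-zeroʳ _) (sym f₀)
anyTrue∧firstTrue {suc L} f one (suc k) | false = begin
  anyTrue (f ∘ suc) ∧ ⌊ suc (firstTrue (f ∘ suc)) ≟ suc k ⌋
    ≡⟨ cong (anyTrue (f ∘ suc) ∧_) (⌊⌋-map′ (cong suc) suc-injective (firstTrue (f ∘ suc) ≟ k)) ⟩
  anyTrue (f ∘ suc) ∧ ⌊ firstTrue (f ∘ suc) ≟ k ⌋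
    ≡⟨ anyTrue∧firstTrue (f ∘ suc) (λ e e′ → suc-injective (one e e′)) k ⟩
  f (suc k) ∎
  where open ≡-Reasoning

module _ {n : ℕ} where

  symmetrise : (Fin n → Fin n → Bool) → Fin n → Fin n → Bool
  symmetrise D u v = D u v ∨ D v u

  Crosses : (Fin n → Bool) → (Fin n → Fin n → Bool) → Set
  Crosses A D = ∀ {u v} → D u v ≡ true → A u ≡ true × A v ≡ false

  crosses-head≢tail : ∀ {A D} → Crosses A D → ∀ {u v w} → D u v ≡ true → D w u ≡ true → ⊥
  crosses-head≢tail crosses uv wu with trans (sym (proj₁ (crosses uv))) (proj₂ (crosses wu))
  ... | ()

  crosses-antisym : ∀ {A D} → Crosses A D → ∀ u v → D u v ∧ D v u ≡ false
  crosses-antisym {A} {D} crosses u v with D u v in uv | D v u in vu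
  ... | false | _     = refl
  ... | true  | false = refl
  ... | true  | true  = ⊥-elim (crosses-head≢tail {A} {D} crosses uv vu)

  crosses-irreflexive : ∀ {A D} → Crosses A D → ∀ u → D u u ≡ false
  crosses-irreflexive {A} {D} crosses u with D u u in uu
  ... | false = refl
  ... | true  = ⊥-elim (crosses-head≢tail {A} {D} crosses uu uu)

  symmetrise-isMatching : ∀ {A D} → Crosses A D →
    (∀ {u v w} → D u v ≡ true → D u w ≡ true → v ≡ w) →
    (∀ {u v w} → D u w ≡ true → D v w ≡ true → u ≡ v) →
    IsMatching (symmetrise D)
  symmetrise-isMatching {A} {D} crosses functional injective u v w uv uw
    with ∨-true (D u v) (D v u) uv | ∨-true (D u w) (D w u) uw
  ... | inj₁ uv′ | inj₁ uw′ = functional uv′ uw′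
  ... | inj₂ vu′ | inj₂ wu′ = injective vu′ wu′
  ... | inj₁ uv′ | inj₂ wu′ = ⊥-elim (crosses-head≢tail {A} {D} crosses uv′ wu′)
  ... | inj₂ vu′ | inj₁ uw′ = ⊥-elim (crosses-head≢tail {A} {D} crosses uw′ vu′)

  countPairs-symmetrise : ∀ {A D} → Crosses A D → countPairs (symmetrise D) ≡ sumF (λ u → countF (D u))
  countPairs-symmetrise {A} {D} crosses = begin
    countPairs (symmetrise D)
      ≡⟨ sumF-cong {n} (λ u → countF≡sumF {n} _) ⟩
    sumF² (λ u v → indicator (⌊ u <? v ⌋ ∧ (D u v ∨ D v u)))
      ≡⟨ sumF-cong {n} (λ u → sumF-cong {n} (λ v → split-∨ ⌊ u <? v ⌋ (crosses-antisym crosses u v))) ⟩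
    sumF² (λ u v → indicator (⌊ u <? v ⌋ ∧ D u v) + indicator (⌊ u <? v ⌋ ∧ D v u))
      ≡⟨ sumF²-+ {n} {n} _ _ ⟩
    sumF² (λ u v → indicator (⌊ u <? v ⌋ ∧ D u v)) + sumF² (λ u v → indicator (⌊ u <? v ⌋ ∧ D v u))
      ≡⟨ cong (sumF² (λ u v → indicator (⌊ u <? v ⌋ ∧ D u v)) +_) (sumF-comm {n} {n} _) ⟩
    sumF² (λ u v → indicator (⌊ u <? v ⌋ ∧ D u v)) + sumF² (λ u v → indicator (⌊ v <? u ⌋ ∧ D u v))
      ≡⟨ sym (sumF²-+ {n} {n} _ _) ⟩
    sumF² (λ u v → indicator (⌊ u <? v ⌋ ∧ D u v) + indicator (⌊ v <? u ⌋ ∧ D u v))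
      ≡⟨ sumF-cong {n} (λ u → sumF-cong {n} (λ v → sym (split-< u v))) ⟩
    sumF² (λ u v → indicator (D u v))
      ≡⟨ sumF-cong {n} (λ u → sym (countF≡sumF (D u))) ⟩
    sumF (λ u → countF (D u)) ∎
    where
    open ≡-Reasoning
    split-∨ : ∀ c {a b} → a ∧ b ≡ false → indicator (c ∧ (a ∨ b)) ≡ indicator (c ∧ a) + indicator (c ∧ b)
    split-∨ true  {a} {b} disjoint = indicator-∨ a b disjoint
    split-∨ false         disjoint = refl
    split-< : ∀ u v → indicator (D u v) ≡ indicator (⌊ u <? v ⌋ ∧ D u v) + indicator (⌊ v <? u ⌋ ∧ D u v)
    split-< u v with u <? v | v <? u
    ... | yes u<v | yes v<u = contradiction u<v (<-asym v<u)
    ... | yes _   | no _    = sym (ℕ.+-identityʳ _)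
    ... | no _    | yes _   = refl
    ... | no u≮v  | no v≮u with <-cmp u v
    ...   | tri< u<v _ _  = contradiction u<v u≮v
    ...   | tri> _ _ v<u  = contradiction v<u v≮u
    ...   | tri≈ _ refl _ = cong indicator (crosses-irreflexive {A} {D} crosses u)

injective-avoids-all-but-one : ∀ {n} {g : Fin n → Fin n} → Injective _≡_ _≡_ g →
                               ∀ x p → (∀ m → m ≢ p → x ≢ g m) → x ≡ g p
injective-avoids-all-but-one {suc n} {g} g-injective x p avoids with any? (λ m → g m ≟ x)
... | no missed = contradiction (λ {m} {m′} → punchOut∘g-injective {m} {m′}) (<⇒notInjective (ℕ.n<1+n n))
  where
  x≢g : ∀ m → x ≢ g m
  x≢g m e = missed (m , sym e)
  punchOut∘g-injective : Injective _≡_ _≡_ (λ m → punchOut (x≢g m))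
  punchOut∘g-injective e = g-injective (punchOut-injective (x≢g _) (x≢g _) e)
... | yes (m , gm≡x) with m ≟ p
...   | yes refl = sym gm≡x
...   | no m≢p   = contradiction (sym gm≡x) (avoids m m≢p)

ordered-pair-within : ∀ {q} {i j : Fin q} → toℕ i < toℕ j → ∀ p p′ →
  does (p <? p′) ∧ ((⌊ p ≟ i ⌋ ∨ ⌊ p ≟ j ⌋) ∧ (⌊ p′ ≟ i ⌋ ∨ ⌊ p′ ≟ j ⌋)) ≡ ⌊ p ≟ i ⌋ ∧ ⌊ p′ ≟ j ⌋
ordered-pair-within {i = i} {j} i<j p p′ with p ≟ i | p ≟ j | p′ ≟ i | p′ ≟ j
... | yes refl | yes refl | _        | _        = contradiction i<j (ℕ.<-irrefl refl)
... | _        | _        | yes refl | yes refl = contradiction i<j (ℕ.<-irrefl refl)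
... | yes refl | no _     | yes refl | no _     = trans (∧-identityʳ _) (dec-false (p <? p) (ℕ.<-irrefl refl))
... | yes refl | no _     | no _     | yes refl = trans (∧-identityʳ _) (dec-true (p <? p′) i<j)
... | yes refl | no _     | no _     | no _     = ∧-zeroʳ _
... | no _     | yes refl | yes refl | no _     = trans (∧-identityʳ _) (dec-false (p <? p′) (ℕ.<-asym i<j))
... | no _     | yes refl | no _     | yes refl = trans (∧-identityʳ _) (dec-false (p <? p) (ℕ.<-irrefl refl))
... | no _     | yes refl | no _     | no _     = ∧-zeroʳ _
... | no _     | no _     | _        | _        = ∧-zeroʳ _

-- For parts i < j, the k-th matching joins (i , a) to (j , φ k i j a) whenever dom k i j a.
module PartialInjectionGraph {q : ℕ} (s : Fin q → ℕ)
  (dom : Fin 4 → Fin q → Fin q → ℕ → Bool)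
  (φ   : Fin 4 → Fin q → Fin q → ℕ → ℕ)
  (φ-range     : ∀ {k i j a} → dom k i j a ≡ true → φ k i j a < s j)
  (φ-injective : ∀ {k i j a a′} → dom k i j a ≡ true → dom k i j a′ ≡ true →
                 φ k i j a ≡ φ k i j a′ → a ≡ a′)
  (φ-disjoint  : ∀ {k k′ i j a} → dom k i j a ≡ true → dom k′ i j a ≡ true →
                 φ k i j a ≡ φ k′ i j a → k ≡ k′)
  where

  link : Fin 4 → Fin q → Fin q → ℕ → ℕ → Bool
  link k i j a b = dom k i j a ∧ does (b ℕ.≟ φ k i j a)

  arc : Fin 4 → Part s → Part s → Bool
  arc k (p , t) (p′ , t′) = does (p <? p′) ∧ link k p p′ (toℕ t) (toℕ t′)

  edge : Fin 4 → Part s → Part s → Bool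
  edge k x y = arc k x y ∨ arc k y x

  arc-sound : ∀ k p p′ t t′ → arc k (p , t) (p′ , t′) ≡ true →
              toℕ p < toℕ p′ × dom k p p′ (toℕ t) ≡ true × toℕ t′ ≡ φ k p p′ (toℕ t)
  arc-sound k p p′ t t′ h with ∧-true {does (p <? p′)} h
  ... | p<p′ , l with ∧-true {dom k p p′ (toℕ t)} l
  ...   | d , e = does-true⇒ (p <? p′) p<p′ , d , does-true⇒ (toℕ t′ ℕ.≟ _) e

  edge-within-part : ∀ k x y → proj₁ x ≡ proj₁ y → edge k x y ≡ false
  edge-within-part k (p , t) (.p , t′) refl =
    cong₂ _∨_ (cong (_∧ link k p p (toℕ t) (toℕ t′)) p≮p) (cong (_∧ link k p p (toℕ t′) (toℕ t)) p≮p)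
    where p≮p = dec-false (p <? p) (ℕ.<-irrefl refl)

  arc-label-unique : ∀ k k′ x y → arc k x y ≡ true → arc k′ x y ≡ true → k ≡ k′
  arc-label-unique k k′ (p , t) (p′ , t′) a a′
    with arc-sound k p p′ t t′ a | arc-sound k′ p p′ t t′ a′
  ... | _ , d , b≡ | _ , d′ , b≡′ = φ-disjoint d d′ (trans (sym b≡) b≡′)

  arcs-antisym : ∀ k k′ x y → arc k x y ≡ true → arc k′ y x ≡ true → ⊥
  arcs-antisym k k′ (p , t) (p′ , t′) a a′ =
    ℕ.<-asym (proj₁ (arc-sound k p p′ t t′ a)) (proj₁ (arc-sound k′ p′ p t′ t a′))

  edge-atMostOne : ∀ x y → AtMostOne (λ k → edge k x y)
  edge-atMostOne x y {k} {k′} e e′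
    with ∨-true (arc k x y) (arc k y x) e | ∨-true (arc k′ x y) (arc k′ y x) e′
  ... | inj₁ xy | inj₁ xy′ = arc-label-unique k k′ x y xy xy′
  ... | inj₂ yx | inj₂ yx′ = arc-label-unique k k′ y x yx yx′
  ... | inj₁ xy | inj₂ yx′ = ⊥-elim (arcs-antisym k k′ x y xy yx′)
  ... | inj₂ yx | inj₁ xy′ = ⊥-elim (arcs-antisym k′ k x y xy′ yx)

  part : Fin (sumF s) → Fin q
  part u = proj₁ (locate s u)

  edges : Fin (sumF s) → Fin (sumF s) → Fin 4 → Bool
  edges u v k = edge k (locate s u) (locate s v)

  edges-sym : ∀ u v k → edges u v k ≡ edges v u k
  edges-sym u v k = ∨-comm (arc k (locate s u) (locate s v)) (arc k (locate s v) (locate s u))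

  nonadjacent-within-part : ∀ u v → part u ≡ part v → anyTrue (edges u v) ≡ false
  nonadjacent-within-part u v same = anyTrue-false (λ k → edge-within-part k (locate s u) (locate s v) same)

  graph : Graph (sumF s)
  graph = record
    { Adj     = λ u v → anyTrue (edges u v)
    ; Adj-sym = λ u v → anyTrue-cong (edges-sym u v)
    ; Adj-irr = λ v → nonadjacent-within-part v v refl
    }

  label : Fin (sumF s) → Fin (sumF s) → Fin 4
  label u v = firstTrue (edges u v)

  label-sym : ∀ u v → label u v ≡ label v u
  label-sym u v = firstTrue-cong (edges-sym u v)

  part-proper : ProperColoring graph q part
  part-proper u v adj same with trans (sym adj) (nonadjacent-within-part u v same)
  ... | ()

  adjacent-by : ∀ k {p p′} t t′ → toℕ p < toℕ p′ → dom k p p′ (toℕ t) ≡ true → toℕ t′ ≡ φ k p p′ (toℕ t) →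
                Adj graph (embed s p t) (embed s p′ t′) ≡ true
  adjacent-by k {p} {p′} t t′ p<p′ d e
    rewrite locate-embed s p t | locate-embed s p′ t′ = anyTrue-intro (λ k → edge k (p , t) (p′ , t′)) k arc-true
    where
    arc-true : edge k (p , t) (p′ , t′) ≡ true
    arc-true rewrite dec-true (p <? p′) p<p′ | d | dec-true (toℕ t′ ℕ.≟ φ k p p′ (toℕ t)) e = refl

  inPair : Fin q → Fin q → Fin q → Bool
  inPair i j p = ⌊ p ≟ i ⌋ ∨ ⌊ p ≟ j ⌋

  cross : Fin 4 → Fin q → Fin q → Part s → Part s → Bool
  cross k i j (p , t) (p′ , t′) = ⌊ p ≟ i ⌋ ∧ (⌊ p′ ≟ j ⌋ ∧ link k p p′ (toℕ t) (toℕ t′))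

  crossing : Fin 4 → Fin q → Fin q → Fin (sumF s) → Fin (sumF s) → Bool
  crossing k i j u v = cross k i j (locate s u) (locate s v)

  arc-within : ∀ k {i j} → toℕ i < toℕ j → ∀ x y →
               arc k x y ∧ (inPair i j (proj₁ x) ∧ inPair i j (proj₁ y)) ≡ cross k i j x y
  arc-within k {i} {j} i<j (p , t) (p′ , t′) = begin
    (does (p <? p′) ∧ l) ∧ (inPair i j p ∧ inPair i j p′)  ≡⟨ ∧.xy∙z≈xz∙y (does (p <? p′)) l _ ⟩
    (does (p <? p′) ∧ (inPair i j p ∧ inPair i j p′)) ∧ l  ≡⟨ cong (_∧ l) (ordered-pair-within i<j p p′) ⟩
    (⌊ p ≟ i ⌋ ∧ ⌊ p′ ≟ j ⌋) ∧ l                            ≡⟨ ∧-assoc ⌊ p ≟ i ⌋ ⌊ p′ ≟ j ⌋ l ⟩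
    ⌊ p ≟ i ⌋ ∧ (⌊ p′ ≟ j ⌋ ∧ l)                            ∎
    where
    open ≡-Reasoning
    l = link k p p′ (toℕ t) (toℕ t′)

  restrictedEdges≡symmetrise : ∀ k {i j} → toℕ i < toℕ j → ∀ u v →
    restrictedEdges graph part label k i j u v ≡ symmetrise (crossing k i j) u v
  restrictedEdges≡symmetrise k {i} {j} i<j u v = begin
    Adj graph u v ∧ (⌊ label u v ≟ k ⌋ ∧ (Wx ∧ Wy))
      ≡⟨ sym (∧-assoc (Adj graph u v) _ _) ⟩
    (Adj graph u v ∧ ⌊ label u v ≟ k ⌋) ∧ (Wx ∧ Wy)
      ≡⟨ cong (_∧ (Wx ∧ Wy)) (anyTrue∧firstTrue (edges u v) (edge-atMostOne x y) k) ⟩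
    (arc k x y ∨ arc k y x) ∧ (Wx ∧ Wy)
      ≡⟨ ∧-distribʳ-∨ (Wx ∧ Wy) (arc k x y) (arc k y x) ⟩
    arc k x y ∧ (Wx ∧ Wy) ∨ arc k y x ∧ (Wx ∧ Wy)
      ≡⟨ cong (λ w → arc k x y ∧ (Wx ∧ Wy) ∨ arc k y x ∧ w) (∧-comm Wx Wy) ⟩
    arc k x y ∧ (Wx ∧ Wy) ∨ arc k y x ∧ (Wy ∧ Wx)
      ≡⟨ cong₂ _∨_ (arc-within k i<j x y) (arc-within k i<j y x) ⟩
    cross k i j x y ∨ cross k i j y x ∎
    where
    open ≡-Reasoning
    x = locate s u
    y = locate s v
    Wx = inPair i j (proj₁ x)
    Wy = inPair i j (proj₁ y)

  cross-sound : ∀ k i j p t p′ t′ → cross k i j (p , t) (p′ , t′) ≡ true →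
                p ≡ i × p′ ≡ j × dom k p p′ (toℕ t) ≡ true × toℕ t′ ≡ φ k p p′ (toℕ t)
  cross-sound k i j p t p′ t′ h with ∧-true {⌊ p ≟ i ⌋} h
  ... | p≡i , h′ with ∧-true {⌊ p′ ≟ j ⌋} h′
  ...   | p′≡j , l with ∧-true {dom k p p′ (toℕ t)} l
  ...     | d , e = ⌊⌋-true⇒ (p ≟ i) p≡i , ⌊⌋-true⇒ (p′ ≟ j) p′≡j , d , does-true⇒ (toℕ t′ ℕ.≟ _) e

  cross-functional : ∀ k i j x y z → cross k i j x y ≡ true → cross k i j x z ≡ true → y ≡ z
  cross-functional k i j (p , t) (p′ , t′) (p″ , t″) xy xz
    with cross-sound k i j p t p′ t′ xy | cross-sound k i j p t p″ t″ xz
  ... | refl , refl , _ , e | _ , refl , _ , e′ = Part-≡ refl (trans e (sym e′))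

  cross-injective : ∀ k i j x y z → cross k i j x z ≡ true → cross k i j y z ≡ true → x ≡ y
  cross-injective k i j (p , t) (p′ , t′) (p″ , t″) xz yz
    with cross-sound k i j p t p″ t″ xz | cross-sound k i j p′ t′ p″ t″ yz
  ... | refl , refl , d , e | refl , _ , d′ , e′ = Part-≡ refl (φ-injective d d′ (trans (sym e) e′))

  crossing-crosses : ∀ k {i j} → toℕ i < toℕ j → Crosses (λ u → ⌊ part u ≟ i ⌋) (crossing k i j)
  crossing-crosses k {i} {j} i<j {u} {v} uv
    with cross-sound k i j (part u) (proj₂ (locate s u)) (part v) (proj₂ (locate s v)) uv
  ... | pu≡i , pv≡j , _ =
    ⌊⌋-yes (part u ≟ i) pu≡i , ⌊⌋-no (part v ≟ i) (λ pv≡i → ℕ.<-irrefl (cong toℕ (trans (sym pv≡i) pv≡j)) i<j)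

  restricted-isMatching : ∀ k {i j} → toℕ i < toℕ j → IsMatching (restrictedEdges graph part label k i j)
  restricted-isMatching k {i} {j} i<j u v w uv uw =
    symmetrise-isMatching (crossing-crosses k i<j)
      (λ {u} {v} {w} → locate-injective s ∘₂ cross-functional k i j (locate s u) (locate s v) (locate s w))
      (λ {u} {v} {w} → locate-injective s ∘₂ cross-injective k i j (locate s u) (locate s v) (locate s w))
      u v w
      (trans (sym (restrictedEdges≡symmetrise k i<j u v)) uv)
      (trans (sym (restrictedEdges≡symmetrise k i<j u w)) uw)

  countF-link : ∀ k i j a → countF {s j} (λ t′ → link k i j a (toℕ t′)) ≡ indicator (dom k i j a)
  countF-link k i j a with dom k i j a in d
  ... | true  = countF-toℕ≡ (φ k i j a) (φ-range d)
  ... | false = countF-false {s j} (λ _ → refl)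

  countF-cross : ∀ k i j p t →
    countF (λ v → cross k i j (p , t) (locate s v)) ≡ indicator (⌊ p ≟ i ⌋ ∧ dom k p j (toℕ t))
  countF-cross k i j p t = begin
    countF (λ v → cross k i j (p , t) (locate s v))
      ≡⟨ countF≡sumF {sumF s} _ ⟩
    sumF (λ v → indicator (cross k i j (p , t) (locate s v)))
      ≡⟨ sumF-locate s (indicator ∘ cross k i j (p , t)) ⟩
    sumPart s (λ p′ t′ → indicator (⌊ p ≟ i ⌋ ∧ (⌊ p′ ≟ j ⌋ ∧ link k p p′ (toℕ t) (toℕ t′))))
      ≡⟨ into-part-j ⟩
    indicator (⌊ p ≟ i ⌋ ∧ dom k p j (toℕ t)) ∎
    where
    open ≡-Reasoning
    into-part-j : sumPart s (λ p′ t′ → indicator (⌊ p ≟ i ⌋ ∧ (⌊ p′ ≟ j ⌋ ∧ link k p p′ (toℕ t) (toℕ t′))))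
                ≡ indicator (⌊ p ≟ i ⌋ ∧ dom k p j (toℕ t))
    into-part-j with p ≟ i
    ... | yes _ = trans (sumPart-at s (λ p′ t′ → link k p p′ (toℕ t) (toℕ t′)) j) (countF-link k p j (toℕ t))
    ... | no _  = sumF-zero (λ p′ → sumF-zero {s p′} (λ _ → refl))

  countPairs-restricted : ∀ k {i j} → toℕ i < toℕ j →
    countPairs (restrictedEdges graph part label k i j) ≡ countF {s i} (λ t → dom k i j (toℕ t))
  countPairs-restricted k {i} {j} i<j = begin
    countPairs (restrictedEdges graph part label k i j)
      ≡⟨ countPairs-cong {sumF s} (restrictedEdges≡symmetrise k i<j) ⟩
    countPairs (symmetrise (crossing k i j))
      ≡⟨ countPairs-symmetrise {sumF s} {D = crossing k i j} (crossing-crosses k i<j) ⟩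
    sumF (λ u → countF (crossing k i j u))
      ≡⟨ sumF-cong {sumF s} (λ u → countF-cross k i j (part u) (proj₂ (locate s u))) ⟩
    sumF (λ u → indicator (⌊ part u ≟ i ⌋ ∧ dom k (part u) j (toℕ (proj₂ (locate s u)))))
      ≡⟨ sumF-locate s (λ (p , t) → indicator (⌊ p ≟ i ⌋ ∧ dom k p j (toℕ t))) ⟩
    sumPart s (λ p t → indicator (⌊ p ≟ i ⌋ ∧ dom k p j (toℕ t)))
      ≡⟨ sumPart-at s (λ p t → dom k p j (toℕ t)) i ⟩
    countF {s i} (λ t → dom k i j (toℕ t)) ∎
    where open ≡-Reasoning

  countF-part : ∀ i → countF (λ u → ⌊ part u ≟ i ⌋) ≡ s i
  countF-part i = begin
    countF (λ u → ⌊ part u ≟ i ⌋)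
      ≡⟨ countF≡sumF {sumF s} _ ⟩
    sumF (λ u → indicator ⌊ part u ≟ i ⌋)
      ≡⟨ sumF-locate s (λ (p , _) → indicator ⌊ p ≟ i ⌋) ⟩
    sumPart s (λ p _ → indicator ⌊ p ≟ i ⌋)
      ≡⟨ sumF-cong (λ p → sumF-cong {s p} (λ _ → cong indicator (sym (∧-identityʳ _)))) ⟩
    sumPart s (λ p _ → indicator (⌊ p ≟ i ⌋ ∧ true))
      ≡⟨ sumPart-at s (λ _ _ → true) i ⟩
    countF {s i} (λ _ → true)
      ≡⟨ countF-true (s i) ⟩
    s i ∎
    where open ≡-Reasoning

-- The four matchings

module Construction (q : ℕ) (q≥2 : 2 ≤ q) (s : Fin q → ℕ)
                    (s-bounds : ∀ i → q + 2 ≤ s i × s i ≤ 2 * q + 2) where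

  q>0 : 0 < q
  q>0 = ℕ.<-≤-trans (s≤s z≤n) q≥2

  instance
    q-nonZero : NonZero q
    q-nonZero = >-nonZero q>0

  core≤s : ∀ i → 2 + q ≤ s i
  core≤s i = subst (_≤ s i) (ℕ.+-comm q 2) (proj₁ (s-bounds i))

  extra : Fin q → ℕ
  extra i = s i ∸ (2 + q)

  s≡q+[2+extra] : ∀ i → s i ≡ q + (2 + extra i)
  s≡q+[2+extra] i = trans (sym (ℕ.m+[n∸m]≡n (core≤s i))) (rearrange q (extra i))
    where
    rearrange : ∀ q e → 2 + q + e ≡ q + (2 + e)
    rearrange = solve-∀

  extra≤q : ∀ i → extra i ≤ q
  extra≤q i = subst (extra i ≤_) (ℕ.m+n∸n≡m q (2 + q)) (ℕ.∸-monoˡ-≤ (2 + q) s≤q+core)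
    where
    rearrange : ∀ q → 2 * q + 2 ≡ q + (2 + q)
    rearrange = solve-∀
    s≤q+core : s i ≤ q + (2 + q)
    s≤q+core = subst (s i ≤_) (rearrange q) (proj₂ (s-bounds i))

  core≤⇒q≤ : ∀ {a} → 2 + q ≤ a → q ≤ a
  core≤⇒q≤ = ℕ.≤-trans (ℕ.m≤n+m q 2)

  -- M₃ : the core vertices extra i … q − 1 to a + 2, and the extra vertices of V_i onto 2 … extra i + 1.
  -- M₄ : 2 … extra j + 1 onto the extra vertices of V_j, and extra j + 2 … q + 1 to a − 2.
  dom : Fin 4 → Fin q → Fin q → ℕ → Bool
  dom 0F i j a = inRange 0 (2 + q) a
  dom 1F i j a = inRange 0 (2 + q) a
  dom 2F i j a = inRange (extra i) q a ∨ inRange (2 + q) (s i) a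
  dom 3F i j a = inRange 2 (2 + q) a

  φ : Fin 4 → Fin q → Fin q → ℕ → ℕ
  φ 0F i j a = a
  φ 1F i j a = if does (suc a ℕ.<? 2 + q) then suc a else 0
  φ 2F i j a = if does (a ℕ.<? q) then 2 + a else a ∸ q
  φ 3F i j a = if does (a ℕ.<? 2 + extra j) then q + a else a ∸ 2

  φ₁-step : ∀ {i j a} → suc a < 2 + q → φ 1F i j a ≡ suc a
  φ₁-step {a = a} h rewrite dec-true (suc a ℕ.<? 2 + q) h = refl

  φ₁-wrap : ∀ {i j a} → ¬ suc a < 2 + q → φ 1F i j a ≡ 0
  φ₁-wrap {a = a} h rewrite dec-false (suc a ℕ.<? 2 + q) h = refl

  wrap-point : ∀ {a} → a < 2 + q → ¬ suc a < 2 + q → a ≡ suc q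
  wrap-point a<r a+1≮r = ℕ.≤-antisym (s≤s⁻¹ a<r) (s≤s⁻¹ (ℕ.≮⇒≥ a+1≮r))

  φ₂-low : ∀ {i j a} → a < q → φ 2F i j a ≡ 2 + a
  φ₂-low {a = a} h rewrite dec-true (a ℕ.<? q) h = refl

  φ₂-high : ∀ {i j a} → q ≤ a → φ 2F i j a ≡ a ∸ q
  φ₂-high {a = a} h rewrite dec-false (a ℕ.<? q) (ℕ.≤⇒≯ h) = refl

  φ₃-low : ∀ {i j a} → a < 2 + extra j → φ 3F i j a ≡ q + a
  φ₃-low {j = j} {a} h rewrite dec-true (a ℕ.<? 2 + extra j) h = refl

  φ₃-high : ∀ {i j a} → 2 + extra j ≤ a → φ 3F i j a ≡ a ∸ 2
  φ₃-high {j = j} {a} h rewrite dec-false (a ℕ.<? 2 + extra j) (ℕ.≤⇒≯ h) = refl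

  dom₂-cases : ∀ {i j a} → dom 2F i j a ≡ true → (extra i ≤ a × a < q) ⊎ (2 + q ≤ a × a < s i)
  dom₂-cases {i} {j} {a} d with ∨-true (inRange (extra i) q a) _ d
  ... | inj₁ low  = inj₁ (inRange-sound (extra i) q low)
  ... | inj₂ high = inj₂ (inRange-sound (2 + q) (s i) high)

  core≤⇒≮q : ∀ {a} → 2 + q ≤ a → ¬ a < q
  core≤⇒≮q r≤a a<q = ℕ.<⇒≱ a<q (core≤⇒q≤ r≤a)

  extra-shift : ∀ {i a} → 2 + q ≤ a → a < s i → a ∸ q < 2 + extra i
  extra-shift {i} {a} r≤a a<s = ℕ.m<n+o⇒m∸n<o a q (subst (a <_) (s≡q+[2+extra] i) a<s)

  φ-range : ∀ {k i j a} → dom k i j a ≡ true → φ k i j a < s j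
  φ-range {0F} {i} {j} d = ℕ.<-≤-trans (proj₂ (inRange-sound 0 (2 + q) d)) (core≤s j)
  φ-range {1F} {i} {j} {a} d with suc a ℕ.<? 2 + q
  ... | yes a+1<r rewrite φ₁-step {i} {j} a+1<r = ℕ.<-≤-trans a+1<r (core≤s j)
  ... | no a+1≮r  rewrite φ₁-wrap {i} {j} a+1≮r = ℕ.<-≤-trans (s≤s z≤n) (core≤s j)
  φ-range {2F} {i} {j} {a} d with dom₂-cases {i} {j} d
  ... | inj₁ (_ , a<q)   rewrite φ₂-low {i} {j} a<q = ℕ.<-≤-trans (s≤s (s≤s a<q)) (core≤s j)
  ... | inj₂ (r≤a , a<s) rewrite φ₂-high {i} {j} (core≤⇒q≤ r≤a) =
    ℕ.<-≤-trans (extra-shift r≤a a<s) (ℕ.≤-trans (s≤s (s≤s (extra≤q i))) (core≤s j))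
  φ-range {3F} {i} {j} {a} d with inRange-sound 2 (2 + q) d | a ℕ.<? 2 + extra j
  ... | _ | yes a<2+e rewrite φ₃-low {i} {j} a<2+e =
    subst (q + a <_) (sym (s≡q+[2+extra] j)) (ℕ.+-monoʳ-< q a<2+e)
  ... | _ , a<r | no a≮2+e rewrite φ₃-high {i} {j} (ℕ.≮⇒≥ a≮2+e) =
    ℕ.<-trans (ℕ.m<n+o⇒m∸n<o a 2 a<r) (ℕ.<-≤-trans (ℕ.m<n+m q (s≤s z≤n)) (core≤s j))

  shifted-apart₂ : ∀ {i j a a′} → extra i ≤ a × a < q → 2 + q ≤ a′ × a′ < s i → φ 2F i j a ≢ φ 2F i j a′
  shifted-apart₂ {i} {j} (e≤a , a<q) (r≤a′ , a′<s) rewrite φ₂-low {i} {j} a<q | φ₂-high {i} {j} (core≤⇒q≤ r≤a′) =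
    ℕ.>⇒≢ (ℕ.<-≤-trans (extra-shift r≤a′ a′<s) (s≤s (s≤s e≤a)))

  shifted-apart₃ : ∀ a {a′} → a′ < 2 + q → a′ ∸ 2 ≢ q + a
  shifted-apart₃ a a′<r = ℕ.<⇒≢ (ℕ.<-≤-trans (ℕ.m<n+o⇒m∸n<o _ 2 a′<r) (ℕ.m≤m+n q a))

  φ-injective : ∀ {k i j a a′} → dom k i j a ≡ true → dom k i j a′ ≡ true → φ k i j a ≡ φ k i j a′ → a ≡ a′
  φ-injective {0F} _ _ e = e
  φ-injective {1F} {i} {j} {a} {a′} d d′ e with suc a ℕ.<? 2 + q | suc a′ ℕ.<? 2 + q
  ... | yes h | yes h′ rewrite φ₁-step {i} {j} h | φ₁-step {i} {j} h′ = ℕ.suc-injective e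
  ... | yes h | no h′  rewrite φ₁-step {i} {j} h | φ₁-wrap {i} {j} h′ = contradiction e λ ()
  ... | no h  | yes h′ rewrite φ₁-wrap {i} {j} h | φ₁-step {i} {j} h′ = contradiction e λ ()
  ... | no h  | no h′  = trans (wrap-point (proj₂ (inRange-sound 0 (2 + q) d)) h)
                              (sym (wrap-point (proj₂ (inRange-sound 0 (2 + q) d′)) h′))
  φ-injective {2F} {i} {j} {a} {a′} d d′ e with dom₂-cases {i} {j} d | dom₂-cases {i} {j} d′
  ... | inj₁ (_ , a<q) | inj₁ (_ , a′<q) rewrite φ₂-low {i} {j} a<q | φ₂-low {i} {j} a′<q =
    ℕ.+-cancelˡ-≡ 2 a a′ e
  ... | inj₂ (r≤a , _) | inj₂ (r≤a′ , _)
    rewrite φ₂-high {i} {j} (core≤⇒q≤ r≤a) | φ₂-high {i} {j} (core≤⇒q≤ r≤a′) =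
    ℕ.∸-cancelʳ-≡ (core≤⇒q≤ r≤a) (core≤⇒q≤ r≤a′) e
  ... | inj₁ low  | inj₂ high = ⊥-elim (shifted-apart₂ {i} {j} low high e)
  ... | inj₂ high | inj₁ low  = ⊥-elim (shifted-apart₂ {i} {j} low high (sym e))
  φ-injective {3F} {i} {j} {a} {a′} d d′ e with a ℕ.<? 2 + extra j | a′ ℕ.<? 2 + extra j
  ... | yes h | yes h′ rewrite φ₃-low {i} {j} h | φ₃-low {i} {j} h′ = ℕ.+-cancelˡ-≡ q a a′ e
  ... | no h  | no h′  rewrite φ₃-high {i} {j} (ℕ.≮⇒≥ h) | φ₃-high {i} {j} (ℕ.≮⇒≥ h′) =
    ℕ.∸-cancelʳ-≡ (proj₁ (inRange-sound 2 (2 + q) d)) (proj₁ (inRange-sound 2 (2 + q) d′)) e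
  ... | yes h | no h′  rewrite φ₃-low {i} {j} h | φ₃-high {i} {j} (ℕ.≮⇒≥ h′) =
    ⊥-elim (shifted-apart₃ a {a′} (proj₂ (inRange-sound 2 (2 + q) d′)) (sym e))
  ... | no h  | yes h′ rewrite φ₃-high {i} {j} (ℕ.≮⇒≥ h) | φ₃-low {i} {j} h′ =
    ⊥-elim (shifted-apart₃ a′ {a} (proj₂ (inRange-sound 2 (2 + q) d)) e)

  φ₀≢φ₁ : ∀ {i j a} → dom 1F i j a ≡ true → φ 0F i j a ≢ φ 1F i j a
  φ₀≢φ₁ {i} {j} {a} d with suc a ℕ.<? 2 + q
  ... | yes h rewrite φ₁-step {i} {j} h = ℕ.<⇒≢ (ℕ.n<1+n a)
  ... | no h  rewrite φ₁-wrap {i} {j} h | wrap-point (proj₂ (inRange-sound 0 (2 + q) d)) h = λ ()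

  φ₀≢φ₂ : ∀ {i j a} → dom 2F i j a ≡ true → φ 0F i j a ≢ φ 2F i j a
  φ₀≢φ₂ {i} {j} {a} d with dom₂-cases {i} {j} d
  ... | inj₁ (_ , a<q) rewrite φ₂-low {i} {j} a<q = ℕ.<⇒≢ (ℕ.m<n+m a {2} (s≤s z≤n))
  ... | inj₂ (r≤a , _) rewrite φ₂-high {i} {j} (core≤⇒q≤ r≤a) = ℕ.>⇒≢ (ℕ.∸-monoʳ-< q>0 (core≤⇒q≤ r≤a))

  φ₀≢φ₃ : ∀ {i j a} → dom 3F i j a ≡ true → φ 0F i j a ≢ φ 3F i j a
  φ₀≢φ₃ {i} {j} {a} d with a ℕ.<? 2 + extra j
  ... | yes h rewrite φ₃-low {i} {j} h = ℕ.<⇒≢ (ℕ.m<n+m a q>0)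
  ... | no h  rewrite φ₃-high {i} {j} (ℕ.≮⇒≥ h) =
    ℕ.>⇒≢ (ℕ.∸-monoʳ-< (s≤s z≤n) (proj₁ (inRange-sound 2 (2 + q) d)))

  φ₁≢φ₂ : ∀ {i j a} → dom 1F i j a ≡ true → dom 2F i j a ≡ true → φ 1F i j a ≢ φ 2F i j a
  φ₁≢φ₂ {i} {j} {a} d d′ with dom₂-cases {i} {j} d′
  ... | inj₁ (_ , a<q) rewrite φ₁-step {i} {j} (s≤s (ℕ.≤-trans a<q (ℕ.n≤1+n q))) | φ₂-low {i} {j} a<q =
    ℕ.<⇒≢ (ℕ.n<1+n (suc a))
  ... | inj₂ (r≤a , _) = contradiction (proj₂ (inRange-sound 0 (2 + q) d)) (ℕ.≤⇒≯ r≤a)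

  φ₁≢φ₃ : ∀ {i j a} → dom 3F i j a ≡ true → φ 1F i j a ≢ φ 3F i j a
  φ₁≢φ₃ {i} {j} {a} d with inRange-sound 2 (2 + q) d | suc a ℕ.<? 2 + q | a ℕ.<? 2 + extra j
  ... | _ | yes h | yes h′ rewrite φ₁-step {i} {j} h | φ₃-low {i} {j} h′ = ℕ.<⇒≢ (ℕ.+-monoˡ-≤ a q≥2)
  ... | _ | yes h | no h′  rewrite φ₁-step {i} {j} h | φ₃-high {i} {j} (ℕ.≮⇒≥ h′) = ℕ.>⇒≢ (s≤s (ℕ.m∸n≤m a 2))
  ... | _ | no h  | yes h′ rewrite φ₁-wrap {i} {j} h | φ₃-low {i} {j} h′ = ℕ.<⇒≢ (ℕ.<-≤-trans q>0 (ℕ.m≤m+n q a))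
  ... | _ , a<r | no h | no h′ rewrite φ₁-wrap {i} {j} h | φ₃-high {i} {j} (ℕ.≮⇒≥ h′) | wrap-point a<r h =
    ℕ.<⇒≢ (ℕ.m<n⇒0<n∸m q≥2)

  φ₂≢φ₃ : ∀ {i j a} → dom 2F i j a ≡ true → dom 3F i j a ≡ true → φ 2F i j a ≢ φ 3F i j a
  φ₂≢φ₃ {i} {j} {a} d d′ with dom₂-cases {i} {j} d | inRange-sound 2 (2 + q) d′
  ... | inj₂ (r≤a , _) | _ , a<r = contradiction a<r (ℕ.≤⇒≯ r≤a)
  ... | inj₁ (_ , a<q) | 2≤a , _ rewrite φ₂-low {i} {j} a<q with a ℕ.<? 2 + extra j
  ...   | yes h rewrite φ₃-low {i} {j} h = ℕ.<⇒≢ (ℕ.+-monoˡ-< a (ℕ.≤-<-trans 2≤a a<q))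
  ...   | no h  rewrite φ₃-high {i} {j} (ℕ.≮⇒≥ h) = ℕ.>⇒≢ (s≤s (ℕ.≤-trans (ℕ.m∸n≤m a 2) (ℕ.n≤1+n a)))

  φ-disjoint : ∀ {k k′ i j a} → dom k i j a ≡ true → dom k′ i j a ≡ true → φ k i j a ≡ φ k′ i j a → k ≡ k′
  φ-disjoint {0F} {0F} _ _ _ = refl
  φ-disjoint {1F} {1F} _ _ _ = refl
  φ-disjoint {2F} {2F} _ _ _ = refl
  φ-disjoint {3F} {3F} _ _ _ = refl
  φ-disjoint {0F} {1F} {i} {j} {a} _ d′ e = contradiction e       (φ₀≢φ₁ {i} {j} {a} d′)
  φ-disjoint {1F} {0F} {i} {j} {a} d _  e = contradiction (sym e) (φ₀≢φ₁ {i} {j} {a} d)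
  φ-disjoint {0F} {2F} {i} {j} {a} _ d′ e = contradiction e       (φ₀≢φ₂ {i} {j} {a} d′)
  φ-disjoint {2F} {0F} {i} {j} {a} d _  e = contradiction (sym e) (φ₀≢φ₂ {i} {j} {a} d)
  φ-disjoint {0F} {3F} {i} {j} {a} _ d′ e = contradiction e       (φ₀≢φ₃ {i} {j} {a} d′)
  φ-disjoint {3F} {0F} {i} {j} {a} d _  e = contradiction (sym e) (φ₀≢φ₃ {i} {j} {a} d)
  φ-disjoint {1F} {2F} {i} {j} {a} d d′ e = contradiction e       (φ₁≢φ₂ {i} {j} {a} d d′)
  φ-disjoint {2F} {1F} {i} {j} {a} d d′ e = contradiction (sym e) (φ₁≢φ₂ {i} {j} {a} d′ d)
  φ-disjoint {1F} {3F} {i} {j} {a} _ d′ e = contradiction e       (φ₁≢φ₃ {i} {j} {a} d′)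
  φ-disjoint {3F} {1F} {i} {j} {a} d _  e = contradiction (sym e) (φ₁≢φ₃ {i} {j} {a} d)
  φ-disjoint {2F} {3F} {i} {j} {a} d d′ e = contradiction e       (φ₂≢φ₃ {i} {j} {a} d d′)
  φ-disjoint {3F} {2F} {i} {j} {a} d d′ e = contradiction (sym e) (φ₂≢φ₃ {i} {j} {a} d′ d)

  countF-dom : ∀ k i j → countF {s i} (λ t → dom k i j (toℕ t)) ≡ msize q k
  countF-dom 0F i j = trans (countF-inRange 0 (2 + q) z≤n (core≤s i)) (ℕ.+-comm 2 q)
  countF-dom 1F i j = trans (countF-inRange 0 (2 + q) z≤n (core≤s i)) (ℕ.+-comm 2 q)
  countF-dom 2F i j = begin
    countF {s i} (λ t → low (toℕ t) ∨ high (toℕ t))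
      ≡⟨ countF-∨ {s i} (low ∘ toℕ) (high ∘ toℕ) (λ t → low∧high (toℕ t)) ⟩
    countF {s i} (low ∘ toℕ) + countF {s i} (high ∘ toℕ)
      ≡⟨ cong₂ _+_ (countF-inRange (extra i) q (extra≤q i) (core≤⇒q≤ (core≤s i)))
                   (countF-inRange (2 + q) (s i) (core≤s i) ℕ.≤-refl) ⟩
    (q ∸ extra i) + extra i
      ≡⟨ ℕ.m∸n+n≡m (extra≤q i) ⟩
    q ∎
    where
    open ≡-Reasoning
    low high : ℕ → Bool
    low  = inRange (extra i) q
    high = inRange (2 + q) (s i)
    low∧high : ∀ a → low a ∧ high a ≡ false
    low∧high a with low a in isLow | high a in isHigh
    ... | false | _     = refl
    ... | true  | false = refl
    ... | true  | true  = contradiction (proj₂ (inRange-sound (extra i) q isLow))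
                                        (core≤⇒≮q (proj₁ (inRange-sound (2 + q) (s i) isHigh)))
  countF-dom 3F i j = countF-inRange 2 (2 + q) (s≤s (s≤s z≤n)) (core≤s i)

  open PartialInjectionGraph s dom φ (λ {k} {i} {j} {a} → φ-range {k} {i} {j} {a})
    (λ {k} {i} {j} {a} {a′} → φ-injective {k} {i} {j} {a} {a′}) φ-disjoint public

  origin : ∀ p → Fin (s p)
  origin p = fromℕ< (ℕ.<-≤-trans (s≤s z≤n) (core≤s p))

  toℕ-origin : ∀ p → toℕ (origin p) ≡ 0
  toℕ-origin p = toℕ-fromℕ< _

  origins-adjacent : ∀ {p p′} → toℕ p < toℕ p′ → Adj graph (embed s p (origin p)) (embed s p′ (origin p′)) ≡ true
  origins-adjacent {p} {p′} p<p′ = adjacent-by 0F (origin p) (origin p′) p<p′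
    (inRange-intro z≤n (subst (_< 2 + q) (sym (toℕ-origin p)) (s≤s z≤n)))
    (trans (toℕ-origin p′) (sym (toℕ-origin p)))

  origin-colours-injective : ∀ {k} (c : Fin (sumF s) → Fin k) → ProperColoring graph k c →
                             Injective _≡_ _≡_ (λ p → c (embed s p (origin p)))
  origin-colours-injective c proper {p} {p′} same with <-cmp p p′
  ... | tri< p<p′ _ _ = contradiction same (proper _ _ (origins-adjacent p<p′))
  ... | tri≈ _ p≡p′ _ = p≡p′
  ... | tri> _ _ p′<p = contradiction (sym same) (proper _ _ (origins-adjacent p′<p))

  not-colourable : ∀ k → k < q → ¬ Colorable graph k
  not-colourable k k<q (c , proper) = <⇒notInjective k<q (origin-colours-injective c proper)

  -- Uniqueness of the colouring

  module UniqueColouring (c : Fin (sumF s) → Fin q) (proper : ProperColoring graph q c) where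

    g : Fin q → Fin q
    g p = c (embed s p (origin p))

    g-injective : Injective _≡_ _≡_ g
    g-injective = origin-colours-injective c proper

    Settled : ℕ → Set
    Settled a = ∀ p (t : Fin (s p)) → toℕ t ≡ a → c (embed s p t) ≡ g p

    Neighbour : (p : Fin q) → Fin (s p) → Fin q → Set
    Neighbour p t m = Σ (Fin (s m)) λ t′ → Adj graph (embed s p t) (embed s m t′) ≡ true × c (embed s m t′) ≡ g m

    settled-by-neighbours : ∀ p t → (∀ m → m ≢ p → Neighbour p t m) → c (embed s p t) ≡ g p
    settled-by-neighbours p t neighbour = injective-avoids-all-but-one g-injective _ p avoids
      where
      avoids : ∀ m → m ≢ p → c (embed s p t) ≢ g m
      avoids m m≢p with neighbour m m≢p
      ... | _ , adj , coloured = λ same → proper _ _ adj (trans same (sym coloured))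

    forward : ∀ k {p m} t b (b<s : b < s m) → toℕ p < toℕ m → dom k p m (toℕ t) ≡ true →
              b ≡ φ k p m (toℕ t) → c (embed s m (fromℕ< b<s)) ≡ g m → Neighbour p t m
    forward k t b b<s p<m d b≡ coloured =
      fromℕ< b<s , adjacent-by k t (fromℕ< b<s) p<m d (trans (toℕ-fromℕ< b<s) b≡) , coloured

    backward : ∀ k {p m} t b (b<s : b < s m) → toℕ m < toℕ p → dom k m p b ≡ true →
               toℕ t ≡ φ k m p b → c (embed s m (fromℕ< b<s)) ≡ g m → Neighbour p t m
    backward k {p} {m} t b b<s m<p d t≡ coloured =
      fromℕ< b<s , trans (Adj-sym graph _ _) (adjacent-by k (fromℕ< b<s) t m<p d′ t≡′) , coloured
      where
      d′  = subst (λ x → dom k m p x ≡ true) (sym (toℕ-fromℕ< b<s)) d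
      t≡′ = trans t≡ (cong (φ k m p) (sym (toℕ-fromℕ< b<s)))

    core-settled : ∀ a → a < 2 + q → Settled a
    core-settled zero    _     p t t≡0 = cong (c ∘ embed s p) (toℕ-injective (trans t≡0 (sym (toℕ-origin p))))
    core-settled (suc a) a+1<r p = climb p (>-wellFounded p)
      where
      a<r : a < 2 + q
      a<r = ℕ.<-trans (ℕ.n<1+n a) a+1<r
      climb : ∀ p → Acc _>_ p → ∀ t → toℕ t ≡ suc a → c (embed s p t) ≡ g p
      climb p (acc higher) t t≡ = settled-by-neighbours p t neighbour
        where
        neighbour : ∀ m → m ≢ p → Neighbour p t m
        neighbour m m≢p with <-cmp m p
        ... | tri< m<p _ _ = backward 1F t a (ℕ.<-≤-trans a<r (core≤s m)) m<p (inRange-intro z≤n a<r)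
                               (trans t≡ (sym (φ₁-step {m} {p} a+1<r))) (core-settled a a<r m _ (toℕ-fromℕ< _))
        ... | tri≈ _ m≡p _ = contradiction m≡p m≢p
        ... | tri> _ _ p<m = forward 0F t (suc a) (ℕ.<-≤-trans a+1<r (core≤s m)) p<m
                               (inRange-intro z≤n (subst (_< 2 + q) (sym t≡) a+1<r)) (sym t≡)
                               (climb m (higher p<m) _ (toℕ-fromℕ< _))

    extra-settled : ∀ p t → 2 + q ≤ toℕ t → c (embed s p t) ≡ g p
    extra-settled p t r≤a = settled-by-neighbours p t neighbour
      where
      a = toℕ t
      b = a ∸ q
      b<2+e : b < 2 + extra p
      b<2+e = extra-shift r≤a (toℕ<n t)
      2≤b : 2 ≤ b
      2≤b = subst (_≤ b) (ℕ.m+n∸n≡m 2 q) (ℕ.∸-monoˡ-≤ q r≤a)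
      b<r : b < 2 + q
      b<r = ℕ.<-≤-trans b<2+e (s≤s (s≤s (extra≤q p)))
      neighbour : ∀ m → m ≢ p → Neighbour p t m
      neighbour m m≢p with <-cmp m p
      ... | tri< m<p _ _ = backward 3F t b (ℕ.<-≤-trans b<r (core≤s m)) m<p (inRange-intro 2≤b b<r)
                             (trans (sym (ℕ.m+[n∸m]≡n (core≤⇒q≤ r≤a))) (sym (φ₃-low {m} {p} b<2+e)))
                             (core-settled b b<r m _ (toℕ-fromℕ< _))
      ... | tri≈ _ m≡p _ = contradiction m≡p m≢p
      ... | tri> _ _ p<m = forward 2F t b (ℕ.<-≤-trans b<r (core≤s m)) p<m
                             (trans (cong (inRange (extra p) q a ∨_) (inRange-intro r≤a (toℕ<n t))) (∨-zeroʳ _))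
                             (sym (φ₂-high {p} {m} (core≤⇒q≤ r≤a)))
                             (core-settled b b<r m _ (toℕ-fromℕ< _))

    all-settled : ∀ p t → c (embed s p t) ≡ g p
    all-settled p t with toℕ t ℕ.<? 2 + q
    ... | yes a<r = core-settled (toℕ t) a<r p t refl
    ... | no  a≮r = extra-settled p t (ℕ.≮⇒≥ a≮r)

    colour≡g∘part : ∀ u → c u ≡ g (part u)
    colour≡g∘part u = trans (cong c (sym (embed-locate s u))) (all-settled _ _)

    same-colour⇔same-part : ∀ u v → (c u ≡ c v → part u ≡ part v) × (part u ≡ part v → c u ≡ c v)
    same-colour⇔same-part u v =
      (λ same → g-injective (trans (sym (colour≡g∘part u)) (trans same (colour≡g∘part v)))) ,
      (λ same → trans (colour≡g∘part u) (trans (cong g same) (sym (colour≡g∘part v))))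

-- The construction works for every q ≥ 2.
lemma3 : (q : ℕ) → 2 ≤ q → 2 ∣ q
    → (s : Fin q → ℕ) → (∀ i → q + 2 ≤ s i × s i ≤ 2 * q + 2)
    → Σ ℕ λ n → Σ (Graph n) λ G → Σ (Fin n → Fin q) λ part
      → (∀ i → countF (λ u → ⌊ part u ≟ i ⌋) ≡ s i)
      × (Σ (Fin n → Fin n → Fin 4) λ lab
          → (∀ u v → Adj G u v ≡ true → lab u v ≡ lab v u)
          × (∀ (k : Fin 4) (i j : Fin q) → toℕ i < toℕ j
              → IsMatching (restrictedEdges G part lab k i j)
              × countPairs (restrictedEdges G part lab k i j) ≡ msize q k))
      × ChromaticNumber G q
      × (∀ (c : Fin n → Fin q) → ProperColoring G q c
          → ∀ u v → (c u ≡ c v → part u ≡ part v) × (part u ≡ part v → c u ≡ c v))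
lemma3 q q≥2 _ s s-bounds =
  sumF s , graph , part , countF-part ,
  (label , (λ u v _ → label-sym u v) ,
   λ k i j i<j → restricted-isMatching k i<j , trans (countPairs-restricted k i<j) (countF-dom k i j)) ,
  ((part , part-proper) , not-colourable) ,
  UniqueColouring.same-colour⇔same-part
  where open Construction q q≥2 s s-bounds
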